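{- If $G$ is a connected cubic graph, then $\gamma_e(G) \ge \frac{3}{5}\mu(G)$.
   Context: All graphs are finite, simple and undirected; a cubic graph is a $3$-regular graph. $\mu(G)$ is the maximum cardinality of a matching (set of pairwise vertex-disjoint edges) of $G$. The edge domination number $\gamma_e(G)$ is the minimum cardinality of a maximal (with respect to inclusion) matching of $G$. -}

module Defs where

open import Data.Nat using (ℕ; zero; suc; _≤_)
open import Data.Fin using (Fin)
open import Data.Fin.Subset using (Subset; ∣_∣)
open import Data.Vec using (tabulate)
open import Data.Bool using (Bool)
open import Data.Product using (Σ; _×_; _,_; ∃-syntax)
open import Data.Sum using (_⊎_)
open import Data.List using (List; length)
open import Data.List.Membership.Propositional using (_∈_)
open import Data.List.Relation.Unary.Unique.Propositional using (Unique)
open import Relation.Nullary using (¬_; Dec)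
open import Relation.Nullary.Decidable using (does)
open import Relation.Binary.PropositionalEquality using (_≡_; _≢_)

record Graph (n : ℕ) : Set₁ where
  field
    Adj     : Fin n → Fin n → Set
    adj?    : (u v : Fin n) → Dec (Adj u v)
    sym     : ∀ {u v} → Adj u v → Adj v u
    irrefl  : ∀ {u} → ¬ Adj u u
open Graph public

neighbours : ∀ {n} → Graph n → Fin n → Subset n
neighbours G v = tabulate (λ u → does (adj? G v u))

degree : ∀ {n} → Graph n → Fin n → ℕ
degree G v = ∣ neighbours G v ∣

Cubic : ∀ {n} → Graph n → Set
Cubic {n} G = ∀ (v : Fin n) → degree G v ≡ 3

data Walk {n} (G : Graph n) : Fin n → Fin n → Set where
  here  : ∀ {u} → Walk G u u
  step  : ∀ {u v w} → Adj G u v → Walk G v w → Walk G u w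

Connected : ∀ {n} → Graph n → Set
Connected {n} G = ∀ (u v : Fin n) → Walk G u v

-- An edge is represented by an ordered pair of adjacent vertices;
-- (u , v) and (v , u) denote the same edge.
Edge : ∀ {n} → Graph n → Set
Edge {n} G = Σ (Fin n × Fin n) λ { (u , v) → Adj G u v }

endpoints : ∀ {n} {G : Graph n} → Edge G → Fin n × Fin n
endpoints (p , _) = p

_incident_ : ∀ {n} {G : Graph n} → Fin n → Edge G → Set
w incident ((u , v) , _) = (w ≡ u) ⊎ (w ≡ v)

Touch : ∀ {n} {G : Graph n} → Edge G → Edge G → Set
Touch {n} {G} e f = ∃[ w ] (_incident_ {G = G} w e × _incident_ {G = G} w f)

-- A matching: a finite set (duplicate-free list) of edges that are
-- pairwise vertex-disjoint (distinct members share no vertex; this also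
-- rules out listing the same edge in both orientations).
record IsMatching {n} (G : Graph n) (M : List (Edge G)) : Set where
  field
    unique   : Unique M
    disjoint : ∀ {e f} → e ∈ M → f ∈ M → e ≢ f → ¬ Touch {G = G} e f

record IsMaximalMatching {n} (G : Graph n) (M : List (Edge G)) : Set where
  field
    matching : IsMatching G M
    maximal  : ∀ (e : Edge G) → ∃[ f ] (f ∈ M × Touch {G = G} e f)

IsMatchingNumber : ∀ {n} → Graph n → ℕ → Set
IsMatchingNumber G k =
  (∃[ M ] (IsMatching G M × length M ≡ k)) ×
  (∀ M → IsMatching G M → length M ≤ k)

IsEdgeDominationNumber : ∀ {n} → Graph n → ℕ → Set
IsEdgeDominationNumber G k =
  (∃[ M ] (IsMaximalMatching G M × length M ≡ k)) ×
  (∀ M → IsMaximalMatching G M → k ≤ length M)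

-- Let M be a maximal matching with m edges. The 2m vertices it covers
-- form S, the rest form D, and D is independent by maximality, so each
-- of its vertices sends all 3 of its edges into S. A vertex of S has its
-- partner in S, hence at most 2 neighbours in D. Counting the S–D edges
-- gives 3|D| ≤ 2|S| = 4m, so n = 2m + |D| ≤ 10m/3, while every matching
-- has at most n/2 ≤ 5m/3 edges.
module Submission where

open import Defs
open import Data.Nat using (ℕ; zero; suc; _+_; _*_; _∸_; _≤_; _<_; z≤n; s≤s)
open import Data.Nat.Properties hiding (_≟_)
open import Data.Nat.Tactic.RingSolver using (solve-∀)
open import Data.Fin using (Fin; zero; suc)
open import Data.Fin.Properties using (_≟_)
open import Data.Fin.Subset using (∣_∣)
open import Data.Vec using (tabulate)
open import Data.Bool using (Bool; true; false)
open import Data.Product using (_×_; _,_; ∃-syntax)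
open import Data.Sum using (_⊎_; inj₁; inj₂)
open import Data.List using (List; []; _∷_; length)
open import Data.List.Membership.Propositional using (_∈_)
open import Data.List.Relation.Unary.Any using (here; there)
open import Data.List.Relation.Unary.All as All using ()
open import Data.List.Relation.Unary.AllPairs using (AllPairs; _∷_)
open import Data.Empty using (⊥-elim)
open import Function using (_∘_)
open import Relation.Nullary using (¬_; yes; no; does)
open import Relation.Binary.PropositionalEquality as ≡ using (_≡_; refl; cong; cong₂)
open import Algebra.Properties.Semiring.Sum +-*-semiring
  using (sum; sum-syntax; sum-cong-≗; sum-replicate-zero; ∑-distrib-+; ∑-comm; *-distribˡ-sum; *-distribʳ-sum)

indicator : Bool → ℕ
indicator true  = 1
indicator false = 0

δ : ∀ {n} → Fin n → Fin n → ℕ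
δ v u = indicator (does (v ≟ u))

∑-mono-≤ : ∀ {n} {f g : Fin n → ℕ} → (∀ i → f i ≤ g i) → sum f ≤ sum g
∑-mono-≤ {zero}  f≤g = z≤n
∑-mono-≤ {suc n} f≤g = +-mono-≤ (f≤g zero) (∑-mono-≤ (f≤g ∘ suc))

∑-mono-< : ∀ {n} {f g : Fin n → ℕ} → (∀ i → f i ≤ g i) → ∀ j → f j < g j → sum f < sum g
∑-mono-< f≤g zero    fj<gj = +-mono-<-≤ fj<gj (∑-mono-≤ (f≤g ∘ suc))
∑-mono-< f≤g (suc j) fj<gj = +-mono-≤-< (f≤g zero) (∑-mono-< (f≤g ∘ suc) j fj<gj)

∑-const-1 : ∀ n → ∑[ i < n ] 1 ≡ n
∑-const-1 zero    = refl
∑-const-1 (suc n) = cong suc (∑-const-1 n)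

∑-δ : ∀ {n} (u : Fin n) → ∑[ v < n ] δ v u ≡ 1
∑-δ {suc n} zero    = cong suc (sum-replicate-zero n)
∑-δ {suc n} (suc u) = ∑-δ u

∣tabulate∣≡∑ : ∀ {n} (p : Fin n → Bool) → ∣ tabulate p ∣ ≡ ∑[ i < n ] indicator (p i)
∣tabulate∣≡∑ {zero}  p = refl
∣tabulate∣≡∑ {suc n} p with p zero
... | true  = cong suc (∣tabulate∣≡∑ (p ∘ suc))
... | false = ∣tabulate∣≡∑ (p ∘ suc)

module _ {n} (G : Graph n) where

  adjacency : Fin n → Fin n → ℕ
  adjacency v u = indicator (does (adj? G v u))

  adjacency-sym : ∀ v u → adjacency v u ≡ adjacency u v
  adjacency-sym v u with adj? G v u | adj? G u v
  ... | yes _   | yes _   = refl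
  ... | no _    | no _    = refl
  ... | yes vu  | no ¬uv  = ⊥-elim (¬uv (sym G vu))
  ... | no ¬vu  | yes uv  = ⊥-elim (¬vu (sym G uv))

  Adj⇒adjacency≡1 : ∀ {v u} → Adj G v u → adjacency v u ≡ 1
  Adj⇒adjacency≡1 {v} {u} vu with adj? G v u
  ... | yes _  = refl
  ... | no ¬vu = ⊥-elim (¬vu vu)

  degree≡∑adjacency : ∀ v → degree G v ≡ ∑[ u < n ] adjacency v u
  degree≡∑adjacency v = ∣tabulate∣≡∑ (λ u → does (adj? G v u))

  ∑-adjacency-transpose : ∀ (f g : Fin n → ℕ) →
    ∑[ v < n ] (f v * ∑[ u < n ] (adjacency v u * g u)) ≡
    ∑[ u < n ] (g u * ∑[ v < n ] (f v * adjacency u v))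
  ∑-adjacency-transpose f g = begin
    ∑[ v < n ] (f v * ∑[ u < n ] (adjacency v u * g u))
      ≡⟨ sum-cong-≗ (λ v → *-distribˡ-sum (f v) (λ u → adjacency v u * g u)) ⟩
    ∑[ v < n ] ∑[ u < n ] (f v * (adjacency v u * g u))
      ≡⟨ ∑-comm (λ v u → f v * (adjacency v u * g u)) ⟩
    ∑[ u < n ] ∑[ v < n ] (f v * (adjacency v u * g u))
      ≡⟨ sum-cong-≗ (λ u → sum-cong-≗ (λ v →
           ≡.trans (regroup (f v) (adjacency v u) (g u)) (cong (λ a → g u * (f v * a)) (adjacency-sym v u)))) ⟩
    ∑[ u < n ] ∑[ v < n ] (g u * (f v * adjacency u v))
      ≡⟨ ≡.sym (sum-cong-≗ (λ u → *-distribˡ-sum (g u) (λ v → f v * adjacency u v))) ⟩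
    ∑[ u < n ] (g u * ∑[ v < n ] (f v * adjacency u v)) ∎
    where
    open ≡.≡-Reasoning
    regroup : ∀ x a y → x * (a * y) ≡ y * (x * a)
    regroup = solve-∀

  -- For a matching this is the indicator of the set of covered vertices.
  endpointCount : List (Edge G) → Fin n → ℕ
  endpointCount []                    v = 0
  endpointCount (((x , y) , _) ∷ M) v = δ v x + δ v y + endpointCount M v

  ∑-endpointCount : ∀ M → ∑[ v < n ] endpointCount M v ≡ 2 * length M
  ∑-endpointCount [] = sum-replicate-zero n
  ∑-endpointCount (((x , y) , _) ∷ M) = begin
    ∑[ v < n ] (δ v x + δ v y + endpointCount M v)
      ≡⟨ ∑-distrib-+ (λ v → δ v x + δ v y) (endpointCount M) ⟩
    ∑[ v < n ] (δ v x + δ v y) + ∑[ v < n ] endpointCount M v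
      ≡⟨ cong₂ _+_ (≡.trans (∑-distrib-+ (λ v → δ v x) (λ v → δ v y)) (cong₂ _+_ (∑-δ x) (∑-δ y)))
                   (∑-endpointCount M) ⟩
    2 + 2 * length M
      ≡⟨ ≡.sym (*-suc 2 (length M)) ⟩
    2 * suc (length M) ∎
    where open ≡.≡-Reasoning

  incident-edge : ∀ M v → 0 < endpointCount M v → ∃[ f ] (f ∈ M × _incident_ {G = G} v f)
  incident-edge (((x , y) , _) ∷ M) v pos with v ≟ x | v ≟ y
  ... | yes v≡x | _       = _ , here refl , inj₁ v≡x
  ... | no _    | yes v≡y = _ , here refl , inj₂ v≡y
  ... | no _    | no _    with incident-edge M v pos
  ...   | f , f∈M , v∈f = f , there f∈M , v∈f

  incident⇒endpointCount-pos : ∀ {M f} v → f ∈ M → _incident_ {G = G} v f → 0 < endpointCount M v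
  incident⇒endpointCount-pos {((x , y) , _) ∷ M} v (here refl) (inj₁ refl) with v ≟ v
  ... | yes _  = s≤s z≤n
  ... | no v≢v = ⊥-elim (v≢v refl)
  incident⇒endpointCount-pos {((x , y) , _) ∷ M} v (here refl) (inj₂ refl) with v ≟ v
  ... | yes _  = ≤-trans (m≤n+m 1 (δ v x)) (m≤m+n _ _)
  ... | no v≢v = ⊥-elim (v≢v refl)
  incident⇒endpointCount-pos {_ ∷ M} v (there f∈M) v∈f =
    ≤-trans (incident⇒endpointCount-pos v f∈M v∈f) (m≤n+m _ _)

  matched-partner : ∀ M u → 0 < endpointCount M u → ∃[ p ] (Adj G u p × 0 < endpointCount M p)
  matched-partner M u pos with incident-edge M u pos
  ... | ((x , y) , xy) , f∈M , inj₁ refl = y , xy , incident⇒endpointCount-pos y f∈M (inj₂ refl)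
  ... | ((x , y) , xy) , f∈M , inj₂ refl = x , sym G xy , incident⇒endpointCount-pos x f∈M (inj₁ refl)

  matching-tail : ∀ {e M} → IsMatching G (e ∷ M) → IsMatching G M
  matching-tail matching = record
    { unique   = tail (IsMatching.unique matching)
    ; disjoint = λ e∈M f∈M → IsMatching.disjoint matching (there e∈M) (there f∈M)
    }
    where tail : ∀ {R} {x : Edge G} {xs} → AllPairs R (x ∷ xs) → AllPairs R xs
          tail (_ ∷ p) = p

  matching-head-uncovered : ∀ {e M} → IsMatching G (e ∷ M) →
    ∀ v → _incident_ {G = G} v e → endpointCount M v ≡ 0
  matching-head-uncovered {M = M} matching v v∈e = n≤0⇒n≡0 (≮⇒≥ uncovered)
    where
    uncovered : ¬ 0 < endpointCount M v
    uncovered pos with incident-edge M v pos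
    ... | f , f∈M , v∈f with IsMatching.unique matching
    ...   | e∉M ∷ _ = IsMatching.disjoint matching (here refl) (there f∈M) (All.lookup e∉M f∈M) (v , v∈e , v∈f)

  endpointCount≤1 : ∀ {M} → IsMatching G M → ∀ v → endpointCount M v ≤ 1
  endpointCount≤1 {[]} _ v = z≤n
  endpointCount≤1 {((x , y) , xy) ∷ M} matching v with v ≟ x | v ≟ y
  ... | yes refl | yes refl = ⊥-elim (irrefl G xy)
  ... | yes refl | no _     = s≤s (≤-reflexive (matching-head-uncovered matching v (inj₁ refl)))
  ... | no _     | yes refl = s≤s (≤-reflexive (matching-head-uncovered matching v (inj₂ refl)))
  ... | no _     | no _     = endpointCount≤1 (matching-tail matching) v

  matching⇒2*length≤n : ∀ {M} → IsMatching G M → 2 * length M ≤ n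
  matching⇒2*length≤n {M} matching = begin
    2 * length M                   ≡⟨ ≡.sym (∑-endpointCount M) ⟩
    ∑[ v < n ] endpointCount M v   ≤⟨ ∑-mono-≤ (endpointCount≤1 matching) ⟩
    ∑[ v < n ] 1                   ≡⟨ ∑-const-1 n ⟩
    n                              ∎
    where open ≤-Reasoning

  maximal⇒unmatched-neighbour-matched : ∀ {M} → IsMaximalMatching G M → ∀ {v u} →
    endpointCount M v ≡ 0 → Adj G v u → 0 < endpointCount M u
  maximal⇒unmatched-neighbour-matched {M} maximal {v} {u} v-free vu
    with IsMaximalMatching.maximal maximal ((v , u) , vu)
  ... | f , f∈M , _ , inj₁ refl , v∈f = ⊥-elim (<⇒≢ (incident⇒endpointCount-pos v f∈M v∈f) (≡.sym v-free))
  ... | f , f∈M , _ , inj₂ refl , u∈f = incident⇒endpointCount-pos u f∈M u∈f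

  maximal⇒∑matched-neighbours≡degree : ∀ {M} → IsMaximalMatching G M → ∀ {v} →
    endpointCount M v ≡ 0 → ∑[ u < n ] (adjacency v u * endpointCount M u) ≡ degree G v
  maximal⇒∑matched-neighbours≡degree {M} maximal {v} v-free =
    ≡.trans (sum-cong-≗ neighbour-matched) (≡.sym (degree≡∑adjacency v))
    where
    neighbour-matched : ∀ u → adjacency v u * endpointCount M u ≡ adjacency v u
    neighbour-matched u with adj? G v u
    ... | no _   = refl
    ... | yes vu = ≡.trans (*-identityˡ _)
      (≤-antisym (endpointCount≤1 (IsMaximalMatching.matching maximal) u)
                 (maximal⇒unmatched-neighbour-matched maximal v-free vu))

  -- The partner of u is a neighbour that is not unmatched.
  matched⇒∑unmatched-neighbours<degree : ∀ M {u} → 0 < endpointCount M u →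
    ∑[ v < n ] ((1 ∸ endpointCount M v) * adjacency u v) < degree G u
  matched⇒∑unmatched-neighbours<degree M {u} u-matched
    with matched-partner M u u-matched
  ... | p , up , p-matched = begin-strict
    ∑[ v < n ] ((1 ∸ endpointCount M v) * adjacency u v) <⟨ ∑-mono-< unmatched≤adjacent p partner-matched ⟩
    ∑[ v < n ] adjacency u v                             ≡⟨ ≡.sym (degree≡∑adjacency u) ⟩
    degree G u                                           ∎
    where
    open ≤-Reasoning
    unmatched≤adjacent : ∀ v → (1 ∸ endpointCount M v) * adjacency u v ≤ adjacency u v
    unmatched≤adjacent v = ≤-trans (*-monoˡ-≤ (adjacency u v) (m∸n≤m 1 (endpointCount M v)))
                                   (≤-reflexive (*-identityˡ _))
    partner-matched : (1 ∸ endpointCount M p) * adjacency u p < adjacency u p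
    partner-matched = begin-strict
      (1 ∸ endpointCount M p) * adjacency u p ≡⟨ cong (_* adjacency u p) (m≤n⇒m∸n≡0 p-matched) ⟩
      0                                       <⟨ s≤s z≤n ⟩
      1                                       ≡⟨ ≡.sym (Adj⇒adjacency≡1 up) ⟩
      adjacency u p                           ∎

  module _ (cubic : Cubic G) {M : List (Edge G)} (maximal : IsMaximalMatching G M) where

    private
      matched : Fin n → ℕ
      matched = endpointCount M

      unmatched : Fin n → ℕ
      unmatched v = 1 ∸ matched v

      matched≤1 : ∀ v → matched v ≤ 1
      matched≤1 = endpointCount≤1 (IsMaximalMatching.matching maximal)

      matched-or-not : ∀ v → matched v ≡ 0 ⊎ matched v ≡ 1
      matched-or-not v = n≤1⇒n≡0∨n≡1 (matched≤1 v)

    cubic⇒3*unmatched≤2*matched : ∑[ v < n ] unmatched v * 3 ≤ ∑[ u < n ] matched u * 2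
    cubic⇒3*unmatched≤2*matched = begin
      ∑[ v < n ] unmatched v * 3
        ≡⟨ *-distribʳ-sum 3 unmatched ⟩
      ∑[ v < n ] (unmatched v * 3)
        ≡⟨ sum-cong-≗ all-edges-to-matched ⟩
      ∑[ v < n ] (unmatched v * ∑[ u < n ] (adjacency v u * matched u))
        ≡⟨ ∑-adjacency-transpose unmatched matched ⟩
      ∑[ u < n ] (matched u * ∑[ v < n ] (unmatched v * adjacency u v))
        ≤⟨ ∑-mono-≤ at-most-two-to-unmatched ⟩
      ∑[ u < n ] (matched u * 2)
        ≡⟨ ≡.sym (*-distribʳ-sum 2 matched) ⟩
      ∑[ u < n ] matched u * 2 ∎
      where
      open ≤-Reasoning
      all-edges-to-matched : ∀ v → unmatched v * 3 ≡ unmatched v * ∑[ u < n ] (adjacency v u * matched u)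
      all-edges-to-matched v with matched-or-not v
      ... | inj₁ free = cong (unmatched v *_)
        (≡.sym (≡.trans (maximal⇒∑matched-neighbours≡degree maximal free) (cubic v)))
      ... | inj₂ taken rewrite taken = refl
      at-most-two-to-unmatched : ∀ u → matched u * ∑[ v < n ] (unmatched v * adjacency u v) ≤ matched u * 2
      at-most-two-to-unmatched u with matched-or-not u
      ... | inj₁ free rewrite free = z≤n
      ... | inj₂ taken = *-monoʳ-≤ (matched u) (≤-pred (≤-trans
        (matched⇒∑unmatched-neighbours<degree M (≤-reflexive (≡.sym taken))) (≤-reflexive (cubic u))))

    cubic⇒3*n≤10*length : 3 * n ≤ 10 * length M
    cubic⇒3*n≤10*length = begin
      3 * n                                ≡⟨ cong (3 *_) n≡matched+unmatched ⟩
      3 * (S + D)                          ≡⟨ ≡.trans (*-distribˡ-+ 3 S D) (cong (3 * S +_) (*-comm 3 D)) ⟩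
      3 * S + D * 3                        ≤⟨ +-monoʳ-≤ (3 * S) cubic⇒3*unmatched≤2*matched ⟩
      3 * S + S * 2                        ≡⟨ cong (λ s → 3 * s + s * 2) (∑-endpointCount M) ⟩
      3 * (2 * length M) + 2 * length M * 2 ≡⟨ ten (length M) ⟩
      10 * length M                        ∎
      where
      open ≤-Reasoning
      S D : ℕ
      S = ∑[ v < n ] matched v
      D = ∑[ v < n ] unmatched v
      n≡matched+unmatched : n ≡ S + D
      n≡matched+unmatched = begin-equality
        n                                    ≡⟨ ≡.sym (∑-const-1 n) ⟩
        ∑[ v < n ] 1                         ≡⟨ sum-cong-≗ (λ v → ≡.sym (m+[n∸m]≡n (matched≤1 v))) ⟩
        ∑[ v < n ] (matched v + unmatched v) ≡⟨ ∑-distrib-+ matched unmatched ⟩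
        S + D                                ∎
      ten : ∀ m → 3 * (2 * m) + 2 * m * 2 ≡ 10 * m
      ten = solve-∀

-- The counting never uses connectedness.
corollary4 : ∀ {n} (G : Graph n) → Connected G → Cubic G →
    ∀ (μ γe : ℕ) → IsMatchingNumber G μ → IsEdgeDominationNumber G γe →
    3 * μ ≤ 5 * γe
corollary4 {n} G _ cubic _ _ ((M* , matching , refl) , _) ((M , maximal , refl) , _) =
  *-cancelˡ-≤ 2 (begin
    2 * (3 * length M*) ≡⟨ swap (length M*) ⟩
    3 * (2 * length M*) ≤⟨ *-monoʳ-≤ 3 (matching⇒2*length≤n G matching) ⟩
    3 * n               ≤⟨ cubic⇒3*n≤10*length G cubic maximal ⟩
    10 * length M       ≡⟨ *-assoc 2 5 (length M) ⟩
    2 * (5 * length M)  ∎)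
  where
  open ≤-Reasoning
  swap : ∀ k → 2 * (3 * k) ≡ 3 * (2 * k)
  swap = solve-∀
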